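{- Let $G$ be an $n \times n$ bipartite graph (with $n \geq 1$). Then \[ \beta(G) \geq \left\lfloor \frac{1}{2} \cdot \sum_{v \in V(G)} \frac{1}{d(v)+1} \right\rfloor, \] where $d(v)$ denotes the degree of $v$ in $G$.
   Context: An $n \times n$ bipartite graph is a bipartite graph $G=(A,B,E)$ with a fixed bipartition into parts $A$ and $B$ satisfying $|A|=|B|=n$. A bi-hole of size $t$ in $G$ is a pair of sets $X \subseteq A$, $Y \subseteq B$ with $|X|=|Y|=t$ such that there is no edge of $G$ between any vertex of $X$ and any vertex of $Y$ (i.e., a copy of $K_{t,t}$ in the bipartite complement of $G$). $\beta(G)$ denotes the largest $k$ for which $G$ has a bi-hole of size $k$. -}

module Defs where

open import Data.Nat using (ℕ; suc; _+_)
open import Data.Bool using (Bool; true; false; if_then_else_)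
open import Data.Fin using (Fin)
open import Data.Fin.Subset using (Subset; _∈_; ∣_∣)
open import Data.Integer using (ℤ; +_)
open import Data.Rational using (ℚ; _/_; floor)
import Data.Rational as ℚ
open import Data.Product using (_×_)
open import Relation.Binary.PropositionalEquality using (_≡_)

-- An n × n bipartite graph G = (A, B, E) with A = B = Fin n (two disjoint
-- copies); E a b = true iff the vertex a ∈ A is adjacent to b ∈ B.
BipGraph : ℕ → Set
BipGraph n = Fin n → Fin n → Bool

sumℕ : ∀ {n} → (Fin n → ℕ) → ℕ
sumℕ {ℕ.zero} f = 0
sumℕ {suc n} f = f Fin.zero + sumℕ (λ i → f (Fin.suc i))

sumℚ : ∀ {n} → (Fin n → ℚ) → ℚ
sumℚ {ℕ.zero} f = ℚ.0ℚ
sumℚ {suc n} f = f Fin.zero ℚ.+ sumℚ (λ i → f (Fin.suc i))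

degA : ∀ {n} → BipGraph n → Fin n → ℕ
degA G a = sumℕ (λ b → if G a b then 1 else 0)

degB : ∀ {n} → BipGraph n → Fin n → ℕ
degB G b = sumℕ (λ a → if G a b then 1 else 0)

invDegSum : ∀ {n} → BipGraph n → ℚ
invDegSum G = sumℚ (λ a → + 1 / suc (degA G a)) ℚ.+ sumℚ (λ b → + 1 / suc (degB G b))

IsBiHole : ∀ {n} → BipGraph n → Subset n → Subset n → ℕ → Set
IsBiHole G X Y t =
  (∣ X ∣ ≡ t) × (∣ Y ∣ ≡ t) × (∀ a b → a ∈ X → b ∈ Y → G a b ≡ false)

module Submission where

-- If k ≤ w(A), let X be k vertices of A of smallest degree, i.e. with a
-- threshold m such that d ≤ m on X and d ≥ m on A ∖ X.  Weighing each vertex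
-- of A by its slack (m + 1 - d inside X, 1 outside) and comparing with
-- (m + 1) k ≤ (m + 1) w(A) shows Σ_{a ∈ X} (d(a) + 1) ≤ n.  Hence X has at most
-- n - k neighbours in B, so k vertices of B see nothing of X: a bi-hole of
-- size k.  By symmetry the same holds with B in place of A, and since
-- t = ⌊w(V)/2⌋ ≤ (w(A) + w(B))/2, t ≤ w(A) or t ≤ w(B).

open import Defs
open import Data.Nat using (ℕ; _≤_)
open import Data.Fin.Subset using (Subset)
open import Data.Product using (∃; _×_)
open import Data.Integer using (+_)
import Data.Integer as ℤ
open import Data.Rational using (floor; _/_)
import Data.Rational as ℚ

open import Algebra.Bundles using (CommutativeRing)
import Algebra.Properties.Semiring.Sum as Sum
open import Data.Bool using (Bool; true; false; if_then_else_; not; T)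
open import Data.Bool.Properties using (T-≡)
open import Data.Empty using (⊥-elim)
open import Data.Fin using (Fin; zero; suc)
open import Data.Fin.Subset using (_∈_; ∣_∣)
import Data.Integer.DivMod as ℤ
import Data.Integer.Properties as ℤ
open import Data.Nat using (zero; suc; _+_; _*_; _∸_; z≤n; s≤s; _≤?_; _<ᵇ_; _≡ᵇ_)
import Data.Nat.Properties as ℕ
open import Data.Product using (_,_)
import Data.Rational.Properties as ℚ
open import Data.Rational.Unnormalised using (ℚᵘ; mkℚᵘ; *≤*; *≡*)
import Data.Rational.Unnormalised as ℚᵘ
import Data.Rational.Unnormalised.Properties as ℚᵘ
open import Data.Sum using (_⊎_; inj₁; inj₂)
open import Data.Unit using (tt)
open import Data.Vec using (_∷_; tabulate)
import Data.Vec.Properties as Vec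
open import Function using (_∘_)
open import Function.Bundles using (Equivalence)
open import Relation.Binary.PropositionalEquality
open import Relation.Nullary using (¬_; yes; no)

open Sum ℕ.+-*-semiring
  using (sum; sum-cong-≗; sum-replicate-zero; ∑-distrib-+; ∑-comm; *-distribˡ-sum)

sumℕ≡sum : ∀ {n} (f : Fin n → ℕ) → sumℕ f ≡ sum f
sumℕ≡sum {zero}  f = refl
sumℕ≡sum {suc n} f = cong (_+_ (f zero)) (sumℕ≡sum (f ∘ suc))

sum-mono : ∀ {n} {f g : Fin n → ℕ} → (∀ i → f i ≤ g i) → sum f ≤ sum g
sum-mono {zero}  f≤g = z≤n
sum-mono {suc n} f≤g = ℕ.+-mono-≤ (f≤g zero) (sum-mono (f≤g ∘ suc))

term≤sum : ∀ {n} (f : Fin n → ℕ) i → f i ≤ sum f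
term≤sum f zero    = ℕ.m≤m+n (f zero) _
term≤sum f (suc i) = ℕ.≤-trans (term≤sum (f ∘ suc) i) (ℕ.m≤n+m _ (f zero))

sum-ones : ∀ n → sum {n} (λ _ → 1) ≡ n
sum-ones zero    = refl
sum-ones (suc n) = cong suc (sum-ones n)

𝟙 : Bool → ℕ
𝟙 b = if b then 1 else 0

Pred : ℕ → Set
Pred n = Fin n → Bool

count : ∀ {n} → Pred n → ℕ
count P = sum (λ i → 𝟙 (P i))

sumOver : ∀ {n} → Pred n → (Fin n → ℕ) → ℕ
sumOver X f = sum (λ i → if X i then f i else 0)

_⇒_ : ∀ {n} → Pred n → Pred n → Set
P ⇒ Q = ∀ i → T (P i) → T (Q i)

𝟙-mono : ∀ {a b} → (T a → T b) → 𝟙 a ≤ 𝟙 b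
𝟙-mono {false}         _   = z≤n
𝟙-mono {true}  {true}  _   = ℕ.≤-refl
𝟙-mono {true}  {false} a⇒b = ⊥-elim (a⇒b tt)

count-false : ∀ n → count {n} (λ _ → false) ≡ 0
count-false n = sum-replicate-zero n

count-mono : ∀ {n} {P Q : Pred n} → P ⇒ Q → count P ≤ count Q
count-mono P⇒Q = sum-mono (λ i → 𝟙-mono (P⇒Q i))

count-complement : ∀ {n} (P : Pred n) → count P + count (not ∘ P) ≡ n
count-complement {n} P = begin
  count P + count (not ∘ P)              ≡⟨ ∑-distrib-+ (𝟙 ∘ P) (𝟙 ∘ not ∘ P) ⟨
  sum (λ i → 𝟙 (P i) + 𝟙 (not (P i)))    ≡⟨ sum-cong-≗ (λ i → one (P i)) ⟩
  sum {n} (λ _ → 1)                      ≡⟨ sum-ones n ⟩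
  n                                      ∎
  where
  open ≡-Reasoning
  one : ∀ b → 𝟙 b + 𝟙 (not b) ≡ 1
  one true  = refl
  one false = refl

Interpolant : ∀ {n} → Pred n → Pred n → ℕ → Set
Interpolant L U k = ∃ λ P → L ⇒ P × P ⇒ U × count P ≡ k

cons : ∀ {n} → Bool → Pred n → Pred (suc n)
cons b P zero    = b
cons b P (suc i) = P i

extend : ∀ {n} {L U : Pred (suc n)} {k} b → (T (L zero) → T b) → (T b → T (U zero)) →
         Interpolant (L ∘ suc) (U ∘ suc) k → Interpolant L U (𝟙 b + k)
extend b L₀⇒b b⇒U₀ (P , L⇒P , P⇒U , countP) =
  cons b P , L⇒bP , bP⇒U , cong (_+_ (𝟙 b)) countP
  where
  L⇒bP : _ ⇒ cons b P
  L⇒bP zero    = L₀⇒b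
  L⇒bP (suc i) = L⇒P i
  bP⇒U : cons b P ⇒ _
  bP⇒U zero    = b⇒U₀
  bP⇒U (suc i) = P⇒U i

-- Proof by induction on n, deciding at point 0: it is forced in (out) when
-- L (not U) contains it; otherwise it is taken only if the rest is too small.
interpolate : ∀ {n} {L U : Pred n} {k} → L ⇒ U → count L ≤ k → k ≤ count U → Interpolant L U k
interpolate {zero} {k = zero} _ _ _ = (λ ()) , (λ ()) , (λ ()) , refl
interpolate {suc n} {L} {U} {k} L⇒U = atZero (L zero) (U zero) refl refl k
  where
  rest : ∀ {k} → count (L ∘ suc) ≤ k → k ≤ count (U ∘ suc) → Interpolant (L ∘ suc) (U ∘ suc) k
  rest = interpolate (L⇒U ∘ suc)
  atZero : ∀ l u → L zero ≡ l → U zero ≡ u → ∀ k →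
           𝟙 l + count (L ∘ suc) ≤ k → k ≤ 𝟙 u + count (U ∘ suc) → Interpolant L U k
  atZero true  false eL eU k _ _ = ⊥-elim (subst T eU (L⇒U zero (subst T (sym eL) tt)))
  atZero true  true  eL eU (suc k) (s≤s lo) (s≤s hi) =
    extend true _ (λ _ → subst T (sym eU) tt) (rest lo hi)
  atZero false u eL eU k lo hi with k ≤? count (U ∘ suc)
  ... | yes hi′ = extend false (subst T eL) (λ ()) (rest lo hi′)
  atZero false true eL eU (suc k) lo (s≤s hi) | no k≰ =
    extend true _ (λ _ → subst T (sym eU) tt) (rest (ℕ.≤-trans (count-mono (L⇒U ∘ suc)) U≤k) hi)
    where
    U≤k : count (U ∘ suc) ≤ k
    U≤k = ℕ.≤-pred (ℕ.≰⇒> k≰)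
  atZero false false eL eU k lo hi | no k≰ = ⊥-elim (k≰ hi)
  atZero false true eL eU zero lo hi | no k≰ = ⊥-elim (k≰ z≤n)

below : ∀ {n} → (Fin n → ℕ) → ℕ → Pred n
below d m i = d i <ᵇ m

threshold : ∀ {n} (d : Fin n → ℕ) k M → k ≤ count (below d (suc M)) →
            ∃ λ m → count (below d m) ≤ k × k ≤ count (below d (suc m))
threshold {n} d k zero    k≤ = 0 , ℕ.≤-trans (ℕ.≤-reflexive (count-false n)) z≤n , k≤
threshold     d k (suc M) k≤ with k ≤? count (below d (suc M))
... | yes k≤′ = threshold d k M k≤′
... | no  k≰  = suc M , ℕ.<⇒≤ (ℕ.≰⇒> k≰) , k≤

-- Choosing k ≤ n smallest values: a set X of size k and a threshold m with
-- values ≤ m on X and ≥ m off X (X interpolates between {d < m} and {d ≤ m}).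
select : ∀ {n} (d : Fin n → ℕ) {k} → k ≤ n →
  ∃ λ (X : Pred n) → count X ≡ k × ∃ λ m →
    (∀ i → T (X i) → d i ≤ m) × (∀ i → ¬ T (X i) → m ≤ d i)
select {n} d {k} k≤n with threshold d k (sum d) k≤all
  where
  k≤all : k ≤ count (below d (suc (sum d)))
  k≤all = ℕ.≤-trans k≤n (ℕ.≤-trans (ℕ.≤-reflexive (sym (sum-ones n)))
    (count-mono {P = λ _ → true} (λ i _ → ℕ.<⇒<ᵇ (s≤s (term≤sum d i)))))
... | m , lo , hi with interpolate (λ i → ℕ.<⇒<ᵇ ∘ ℕ.m<n⇒m<1+n ∘ ℕ.<ᵇ⇒< (d i) m) lo hi
... | X , below⇒X , X⇒below , countX =
  X , countX , m , (λ i → ℕ.≤-pred ∘ ℕ.<ᵇ⇒< (d i) (suc m) ∘ X⇒below i)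
                 , (λ i i∉X → ℕ.≮⇒≥ (i∉X ∘ below⇒X i ∘ ℕ.<⇒<ᵇ))

module Σᵘ = Sum (CommutativeRing.semiring ℚᵘ.+-*-commutativeRing)

ι : ℕ → ℚᵘ
ι n = mkℚᵘ (+ n) 0

-- The rational 1/(d+1).
recip : ℕ → ℚᵘ
recip d = mkℚᵘ (+ 1) d

ι-+ : ∀ a b → ι a ℚᵘ.+ ι b ℚᵘ.≃ ι (a + b)
ι-+ a b = *≡* (cong₂ (λ x y → (x ℤ.+ y) ℤ.* + 1) (ℤ.*-identityʳ (+ a)) (ℤ.*-identityʳ (+ b)))

ι-* : ∀ a b → ι a ℚᵘ.* ι b ℚᵘ.≃ ι (a * b)
ι-* a b = *≡* (cong (ℤ._* + 1) (sym (ℤ.pos-* a b)))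

ι-cancel-≤ : ∀ {a b} → ι a ℚᵘ.≤ ι b → a ≤ b
ι-cancel-≤ {a} {b} (*≤* a≤b) =
  ℤ.drop‿+≤+ (subst₂ ℤ._≤_ (ℤ.*-identityʳ (+ a)) (ℤ.*-identityʳ (+ b)) a≤b)

ι-sum : ∀ {n} (c : Fin n → ℕ) → Σᵘ.sum (ι ∘ c) ℚᵘ.≃ ι (sum c)
ι-sum {zero}  c = ℚᵘ.≃-refl
ι-sum {suc n} c = ℚᵘ.≃-trans (ℚᵘ.+-congʳ (ι (c zero)) (ι-sum (c ∘ suc))) (ι-+ (c zero) _)

sumᵘ-mono : ∀ {n} {f g : Fin n → ℚᵘ} → (∀ i → f i ℚᵘ.≤ g i) → Σᵘ.sum f ℚᵘ.≤ Σᵘ.sum g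
sumᵘ-mono {zero}  f≤g = ℚᵘ.≤-refl
sumᵘ-mono {suc n} f≤g = ℚᵘ.+-mono-≤ (f≤g zero) (sumᵘ-mono (f≤g ∘ suc))

scaled-recip : ∀ {M c} d → M ≤ c * suc d → ι M ℚᵘ.* recip d ℚᵘ.≤ ι c
scaled-recip {M} {c} d M≤c[d+1] = *≤* (subst₂ ℤ._≤_ lhs rhs (ℤ.+≤+ (begin
  M * 1 * 1        ≡⟨ ℕ.*-identityʳ (M * 1) ⟩
  M * 1            ≡⟨ ℕ.*-identityʳ M ⟩
  M                ≤⟨ M≤c[d+1] ⟩
  c * suc d        ≡⟨ cong (c *_) (ℕ.*-identityˡ (suc d)) ⟨
  c * (1 * suc d)  ∎)))
  where
  open ℕ.≤-Reasoning
  lhs : + (M * 1 * 1) ≡ + M ℤ.* + 1 ℤ.* + 1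
  lhs = trans (ℤ.pos-* (M * 1) 1) (cong (ℤ._* + 1) (ℤ.pos-* M 1))
  rhs : + (c * (1 * suc d)) ≡ + c ℤ.* + (1 * suc d)
  rhs = ℤ.pos-* c (1 * suc d)

weighted-bound : ∀ {n} (d c : Fin n → ℕ) M k → (∀ i → M ≤ c i * suc (d i)) →
                 ι k ℚᵘ.≤ Σᵘ.sum (recip ∘ d) → M * k ≤ sum c
weighted-bound d c M k M≤c[d+1] k≤Σ = ι-cancel-≤ (begin
  ι (M * k)                        ≃⟨ ι-* M k ⟨
  ι M ℚᵘ.* ι k                     ≤⟨ ℚᵘ.*-monoʳ-≤-nonNeg (ι M) k≤Σ ⟩
  ι M ℚᵘ.* Σᵘ.sum (recip ∘ d)      ≃⟨ Σᵘ.*-distribˡ-sum (ι M) (recip ∘ d) ⟩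
  Σᵘ.sum (λ i → ι M ℚᵘ.* recip (d i)) ≤⟨ sumᵘ-mono (λ i → scaled-recip (d i) (M≤c[d+1] i)) ⟩
  Σᵘ.sum (ι ∘ c)                   ≃⟨ ι-sum c ⟩
  ι (sum c)                        ∎)
  where open ℚᵘ.≤-Reasoning

sumOver-suc : ∀ {n} (X : Pred n) (f : Fin n → ℕ) → sumOver X (suc ∘ f) ≡ count X + sumOver X f
sumOver-suc X f = trans (sum-cong-≗ split) (∑-distrib-+ (𝟙 ∘ X) (λ i → if X i then f i else 0))
  where
  split : ∀ i → (if X i then suc (f i) else 0) ≡ 𝟙 (X i) + (if X i then f i else 0)
  split i with X i
  ... | true  = refl
  ... | false = refl

slack-suffices : ∀ {m d} → d ≤ m → suc m ≤ (suc m ∸ d) * suc d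
slack-suffices {m} {d} d≤m = begin
  suc m                      ≡⟨ cong suc (ℕ.m+[n∸m]≡n d≤m) ⟨
  suc (d + (m ∸ d))          ≤⟨ s≤s (ℕ.+-monoʳ-≤ d (ℕ.m≤m*n (m ∸ d) (suc d))) ⟩
  suc (m ∸ d) * suc d        ≡⟨ cong (_* suc d) (ℕ.+-∸-assoc 1 d≤m) ⟨
  (suc m ∸ d) * suc d        ∎
  where open ℕ.≤-Reasoning

slack-refills : ∀ {m d} → d ≤ m → (suc m ∸ d) + suc d ≡ suc m * 1 + 1
slack-refills {m} {d} d≤m = begin
  (suc m ∸ d) + suc d        ≡⟨ ℕ.+-suc (suc m ∸ d) d ⟩
  suc ((suc m ∸ d) + d)      ≡⟨ cong suc (ℕ.m∸n+n≡m (ℕ.m≤n⇒m≤1+n d≤m)) ⟩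
  suc (suc m)                ≡⟨ ℕ.+-comm 1 (suc m) ⟩
  suc m + 1                  ≡⟨ cong (_+ 1) (ℕ.*-identityʳ (suc m)) ⟨
  suc m * 1 + 1              ∎
  where open ≡-Reasoning

-- Weigh vertex i with its
-- slack (m + 1 - d i inside X, 1 outside): the weighted bound gives
-- (m + 1) k ≤ Σ slack, while Σ slack + Σ_{X} (d + 1) = (m + 1) k + n.
threshold-set-is-light : ∀ {n} (d : Fin n → ℕ) k (X : Pred n) m → count X ≡ k →
  (∀ i → T (X i) → d i ≤ m) → (∀ i → ¬ T (X i) → m ≤ d i) →
  ι k ℚᵘ.≤ Σᵘ.sum (recip ∘ d) → sumOver X (suc ∘ d) ≤ n
threshold-set-is-light {n} d k X m countX inX outX k≤Σ = ℕ.+-cancelˡ-≤ (suc m * k) _ n bound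
  where
  slack : Fin n → ℕ
  slack i = if X i then suc m ∸ d i else 1
  suffices : ∀ i → suc m ≤ slack i * suc (d i)
  suffices i with X i in e
  ... | true  = slack-suffices (inX i (subst T (sym e) _))
  ... | false = s≤s (ℕ.≤-trans (outX i (subst T e)) (ℕ.m≤m+n (d i) 0))
  refills : ∀ i → slack i + (if X i then suc (d i) else 0) ≡ suc m * 𝟙 (X i) + 1
  refills i with X i in e
  ... | true  = slack-refills (inX i (subst T (sym e) _))
  ... | false = cong (_+ 1) (sym (ℕ.*-zeroʳ m))
  total : sum slack + sumOver X (suc ∘ d) ≡ suc m * k + n
  total = begin
    sum slack + sumOver X (suc ∘ d)                       ≡⟨ ∑-distrib-+ slack _ ⟨
    sum (λ i → slack i + (if X i then suc (d i) else 0))  ≡⟨ sum-cong-≗ refills ⟩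
    sum (λ i → suc m * 𝟙 (X i) + 1)                       ≡⟨ ∑-distrib-+ (λ i → suc m * 𝟙 (X i)) (λ _ → 1) ⟩
    sum (λ i → suc m * 𝟙 (X i)) + sum {n} (λ _ → 1)       ≡⟨ cong₂ _+_ (sym (*-distribˡ-sum (suc m) (𝟙 ∘ X))) (sum-ones n) ⟩
    suc m * count X + n                                   ≡⟨ cong (λ c → suc m * c + n) countX ⟩
    suc m * k + n                                         ∎
    where open ≡-Reasoning
  bound : suc m * k + sumOver X (suc ∘ d) ≤ suc m * k + n
  bound = begin
    suc m * k + sumOver X (suc ∘ d)  ≤⟨ ℕ.+-monoˡ-≤ _ (weighted-bound d slack (suc m) k suffices k≤Σ) ⟩
    sum slack + sumOver X (suc ∘ d)  ≡⟨ total ⟩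
    suc m * k + n                    ∎
    where open ℕ.≤-Reasoning

light-set : ∀ {n} (d : Fin n → ℕ) k → ι k ℚᵘ.≤ Σᵘ.sum (recip ∘ d) →
  ∃ λ (X : Pred n) → count X ≡ k × count X + sumOver X d ≤ n
light-set {n} d k k≤Σ with select d k≤n
  where
  k≤n : k ≤ n
  k≤n = subst₂ _≤_ (ℕ.*-identityˡ k) (sum-ones n)
    (weighted-bound d (λ _ → 1) 1 k (λ _ → s≤s z≤n) k≤Σ)
... | X , countX , m , inX , outX =
  X , countX , subst (_≤ n) (sumOver-suc X d) (threshold-set-is-light d k X m countX inX outX k≤Σ)

Hole : ∀ {n} → BipGraph n → ℕ → Set
Hole {n} G t = ∃ λ (X : Subset n) → ∃ λ (Y : Subset n) → IsBiHole G X Y t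

∣tabulate∣ : ∀ {n} (P : Pred n) → ∣ tabulate P ∣ ≡ count P
∣tabulate∣ {zero}  P = refl
∣tabulate∣ {suc n} P =
  trans (∣∷∣ (P zero) (tabulate (P ∘ suc))) (cong (_+_ (𝟙 (P zero))) (∣tabulate∣ (P ∘ suc)))
  where
  ∣∷∣ : ∀ {n} b (xs : Subset n) → ∣ b ∷ xs ∣ ≡ 𝟙 b + ∣ xs ∣
  ∣∷∣ true  xs = refl
  ∣∷∣ false xs = refl

∈tabulate : ∀ {n} {P : Pred n} {i} → i ∈ tabulate P → T (P i)
∈tabulate {P = P} {i} i∈P =
  Equivalence.from T-≡ (trans (sym (Vec.lookup∘tabulate P i)) (Vec.[]=⇒lookup i∈P))

hits : ∀ {n} → BipGraph n → Pred n → Fin n → ℕ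
hits G X b = sumOver X (λ a → 𝟙 (G a b))

isolated : ∀ {n} → BipGraph n → Pred n → Pred n
isolated G X b = hits G X b ≡ᵇ 0

sum-hits : ∀ {n} (G : BipGraph n) (X : Pred n) → sum (hits G X) ≡ sumOver X (degA G)
sum-hits {n} G X = trans (∑-comm (λ b a → if X a then 𝟙 (G a b) else 0)) (sum-cong-≗ row)
  where
  row : ∀ a → sum (λ b → if X a then 𝟙 (G a b) else 0) ≡ (if X a then degA G a else 0)
  row a with X a
  ... | true  = sym (sumℕ≡sum (𝟙 ∘ G a))
  ... | false = sum-replicate-zero n

non-isolated≤hits : ∀ {n} (G : BipGraph n) (X : Pred n) →
                    count (not ∘ isolated G X) ≤ sum (hits G X)
non-isolated≤hits G X = sum-mono (λ b → nonzero (hits G X b))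
  where
  nonzero : ∀ x → 𝟙 (not (x ≡ᵇ 0)) ≤ x
  nonzero zero    = z≤n
  nonzero (suc x) = s≤s z≤n

-- A light set X ⊆ A sees at most n - |X| vertices of B, leaving |X| isolated ones.
many-isolated : ∀ {n} (G : BipGraph n) (X : Pred n) → count X + sumOver X (degA G) ≤ n →
                count X ≤ count (isolated G X)
many-isolated {n} G X light = ℕ.+-cancelʳ-≤ _ (count X) (count (isolated G X)) (begin
  count X + count (not ∘ isolated G X)              ≤⟨ ℕ.+-monoʳ-≤ (count X) (non-isolated≤hits G X) ⟩
  count X + sum (hits G X)                          ≡⟨ cong (_+_ (count X)) (sum-hits G X) ⟩
  count X + sumOver X (degA G)                      ≤⟨ light ⟩
  n                                                 ≡⟨ count-complement (isolated G X) ⟨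
  count (isolated G X) + count (not ∘ isolated G X) ∎)
  where open ℕ.≤-Reasoning

isolated-no-edge : ∀ {n} (G : BipGraph n) (X : Pred n) a b →
                   T (X a) → T (isolated G X b) → G a b ≡ false
isolated-no-edge G X a b a∈X b-iso = no-hit (X a) (G a b) a∈X
  (subst (_ ≤_) (ℕ.≡ᵇ⇒≡ _ 0 b-iso) (term≤sum (λ a → if X a then 𝟙 (G a b) else 0) a))
  where
  no-hit : ∀ x g → T x → (if x then 𝟙 g else 0) ≤ 0 → g ≡ false
  no-hit true false _ _ = refl

hole-beside : ∀ {n} (G : BipGraph n) (X : Pred n) → count X + sumOver X (degA G) ≤ n →
              Hole G (count X)
hole-beside {n} G X light
  with interpolate {L = λ _ → false} (λ _ ()) (ℕ.≤-trans (ℕ.≤-reflexive (count-false n)) z≤n)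
                   (many-isolated G X light)
... | Y , _ , Y⇒iso , countY =
  tabulate X , tabulate Y , ∣tabulate∣ X , trans (∣tabulate∣ Y) countY ,
  λ a b a∈X b∈Y → isolated-no-edge G X a b (∈tabulate a∈X) (Y⇒iso b (∈tabulate b∈Y))

hole-from-A : ∀ {n} (G : BipGraph n) k → ι k ℚᵘ.≤ Σᵘ.sum (recip ∘ degA G) → Hole G k
hole-from-A G k k≤Σ with light-set (degA G) k k≤Σ
... | X , refl , light = hole-beside G X light

transpose : ∀ {n} → BipGraph n → BipGraph n
transpose G b a = G a b

hole-transpose : ∀ {n} {G : BipGraph n} {k} → Hole (transpose G) k → Hole G k
hole-transpose (X , Y , cX , cY , noEdge) = Y , X , cY , cX , λ a b a∈Y b∈X → noEdge b a b∈X a∈Y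

hole-from-B : ∀ {n} (G : BipGraph n) k → ι k ℚᵘ.≤ Σᵘ.sum (recip ∘ degB G) → Hole G k
hole-from-B G k k≤Σ = hole-transpose (hole-from-A (transpose G) k k≤Σ)

toℚᵘ-sumℚ : ∀ {n} (f : Fin n → ℚ.ℚ) → ℚ.toℚᵘ (sumℚ f) ℚᵘ.≃ Σᵘ.sum (ℚ.toℚᵘ ∘ f)
toℚᵘ-sumℚ {zero}  f = ℚᵘ.≃-refl
toℚᵘ-sumℚ {suc n} f = ℚᵘ.≃-trans (ℚ.toℚᵘ-homo-+ (f zero) _)
  (ℚᵘ.+-congʳ (ℚ.toℚᵘ (f zero)) (toℚᵘ-sumℚ (f ∘ suc)))

invDegSum≃ : ∀ {n} (G : BipGraph n) →
  ℚ.toℚᵘ (invDegSum G) ℚᵘ.≃ Σᵘ.sum (recip ∘ degA G) ℚᵘ.+ Σᵘ.sum (recip ∘ degB G)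
invDegSum≃ G = ℚᵘ.≃-trans (ℚ.toℚᵘ-homo-+ (part (degA G)) (part (degB G)))
  (ℚᵘ.+-cong (side (degA G)) (side (degB G)))
  where
  part : ∀ {n} → (Fin n → ℕ) → ℚ.ℚ
  part d = sumℚ (λ i → + 1 / suc (d i))
  side : ∀ {n} (d : Fin n → ℕ) → ℚ.toℚᵘ (part d) ℚᵘ.≃ Σᵘ.sum (recip ∘ d)
  side d = ℚᵘ.≃-trans (toℚᵘ-sumℚ (λ i → + 1 / suc (d i)))
    (Σᵘ.sum-cong-≋ (λ i → ℚ.toℚᵘ-fromℚᵘ (recip (d i))))

half-double : ∀ x → ℚᵘ.½ ℚᵘ.* (x ℚᵘ.+ x) ℚᵘ.≃ x
half-double x = begin-equality
  ℚᵘ.½ ℚᵘ.* (x ℚᵘ.+ x)                 ≃⟨ ℚᵘ.*-distribˡ-+ ℚᵘ.½ x x ⟩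
  ℚᵘ.½ ℚᵘ.* x ℚᵘ.+ ℚᵘ.½ ℚᵘ.* x         ≃⟨ ℚᵘ.*-distribʳ-+ x ℚᵘ.½ ℚᵘ.½ ⟨
  (ℚᵘ.½ ℚᵘ.+ ℚᵘ.½) ℚᵘ.* x              ≃⟨ ℚᵘ.*-congʳ {x} {ℚᵘ.½ ℚᵘ.+ ℚᵘ.½} {ℚᵘ.1ℚᵘ} (*≡* refl) ⟩
  ℚᵘ.1ℚᵘ ℚᵘ.* x                        ≃⟨ ℚᵘ.*-identityˡ x ⟩
  x                                    ∎
  where open ℚᵘ.≤-Reasoning

≤-half-sum : ∀ x a b → x ℚᵘ.≤ ℚᵘ.½ ℚᵘ.* (a ℚᵘ.+ b) → x ℚᵘ.≤ a ⊎ x ℚᵘ.≤ b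
≤-half-sum x a b x≤avg with x ℚᵘ.≤? a | x ℚᵘ.≤? b
... | yes x≤a | _       = inj₁ x≤a
... | no  _   | yes x≤b = inj₂ x≤b
... | no  x≰a | no  x≰b = ⊥-elim (ℚᵘ.<-irrefl ℚᵘ.≃-refl (begin-strict
  x                           ≤⟨ x≤avg ⟩
  ℚᵘ.½ ℚᵘ.* (a ℚᵘ.+ b)        <⟨ ℚᵘ.*-monoʳ-<-pos ℚᵘ.½ (ℚᵘ.+-mono-< (ℚᵘ.≰⇒> x≰a) (ℚᵘ.≰⇒> x≰b)) ⟩
  ℚᵘ.½ ℚᵘ.* (x ℚᵘ.+ x)        ≃⟨ half-double x ⟩
  x                           ∎))
  where open ℚᵘ.≤-Reasoning

floor-≤ : ∀ q {t} → floor q ≡ + t → ι t ℚᵘ.≤ ℚ.toℚᵘ q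
floor-≤ q@(ℚ.mkℚ num den _) ⌊q⌋≡t =
  subst (λ z → mkℚᵘ z 0 ℚᵘ.≤ ℚ.toℚᵘ q) ⌊q⌋≡t
    (*≤* (subst (ℤ._≤_ _) (sym (ℤ.*-identityʳ num)) (ℤ.[n/d]*d≤n num (+ suc den))))

hole-of-half-weight : ∀ {n} (G : BipGraph n) t →
  ι t ℚᵘ.≤ ℚ.toℚᵘ ((+ 1 / 2) ℚ.* invDegSum G) → Hole G t
hole-of-half-weight G t t≤ with ≤-half-sum (ι t) _ _ (ℚᵘ.≤-respʳ-≃ weight≃ t≤)
  where
  half≃ : ℚ.toℚᵘ (+ 1 / 2) ℚᵘ.≃ ℚᵘ.½
  half≃ = *≡* refl
  weight≃ : ℚ.toℚᵘ ((+ 1 / 2) ℚ.* invDegSum G) ℚᵘ.≃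
            ℚᵘ.½ ℚᵘ.* (Σᵘ.sum (recip ∘ degA G) ℚᵘ.+ Σᵘ.sum (recip ∘ degB G))
  weight≃ = ℚᵘ.≃-trans (ℚ.toℚᵘ-homo-* (+ 1 / 2) (invDegSum G)) (ℚᵘ.*-cong half≃ (invDegSum≃ G))
... | inj₁ t≤A = hole-from-A G t t≤A
... | inj₂ t≤B = hole-from-B G t t≤B

-- The trivial bi-hole, for a negative floor.
empty-hole : ∀ {n} (G : BipGraph n) → Hole G 0
empty-hole {n} G = ∅ , ∅ , empty , empty , λ a _ a∈∅ _ → ⊥-elim (∈tabulate a∈∅)
  where
  ∅ : Subset n
  ∅ = tabulate (λ _ → false)
  empty : ∣ ∅ ∣ ≡ 0
  empty = trans (∣tabulate∣ {n} (λ _ → false)) (count-false n)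

theorem2 : (n : ℕ) → 1 ≤ n → (G : BipGraph n) →
    ∃ λ (t : ℕ) → ∃ λ (X : Subset n) → ∃ λ (Y : Subset n) →
      IsBiHole G X Y t × floor ((+ 1 / 2) ℚ.* invDegSum G) ℤ.≤ + t
theorem2 n _ G with floor ((+ 1 / 2) ℚ.* invDegSum G) in ⌊w⌋≡
... | ℤ.-[1+ _ ] with empty-hole G
...   | X , Y , hole = 0 , X , Y , hole , ℤ.-≤+
theorem2 n _ G | + t with hole-of-half-weight G t (floor-≤ _ ⌊w⌋≡)
...   | X , Y , hole = t , X , Y , hole , ℤ.≤-refl
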